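{- Let $k\geq 1$. For distinct vertices $\mathbf{u},\mathbf{w}$ of $\Omega_{2k}$, $\mathbf{u}$ and $\mathbf{w}$ are twins (i.e. $N(\mathbf{u}) = N(\mathbf{w})$) if and only if $\mathbf{w}=\mathbf{u}+\mathbf{1}$. In particular, $V(\Omega_{2k})$ is partitioned into twin pairs $\{\mathbf{u},\mathbf{u}+\mathbf{1}\}$, and there is no set of three or more vertices that are pairwise twins.
   Context: The orthogonality graph $\Omega_{2k}$ has vertex set $\mathbb{Z}_2^{2k}$ (bitstrings of length $2k$), with two vertices adjacent if and only if they differ in exactly $k$ positions. $\mathbf{1}$ is the all-ones bitstring and $+$ is bitwise addition mod 2. $N(\mathbf{u})$ is the set of neighbors of $\mathbf{u}$. -}

module Defs where

open import Data.Nat using (ℕ; zero; suc; _*_)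
open import Data.Bool using (Bool; true; false; _xor_)
open import Data.Vec using (Vec; []; _∷_; zipWith; replicate)
open import Relation.Binary.PropositionalEquality using (_≡_)
open import Function.Bundles using (_⇔_)

V : ℕ → Set
V k = Vec Bool (2 * k)

hamming : ∀ {n} → Vec Bool n → Vec Bool n → ℕ
hamming [] [] = zero
hamming (x ∷ xs) (y ∷ ys) with x xor y
... | true  = suc (hamming xs ys)
... | false = hamming xs ys

Adj : (k : ℕ) → V k → V k → Set
Adj k u w = hamming u w ≡ k

_⊕_ : ∀ {n} → Vec Bool n → Vec Bool n → Vec Bool n
_⊕_ = zipWith _xor_

𝟏 : ∀ {n} → Vec Bool n
𝟏 = replicate _ true

Twins : (k : ℕ) → V k → V k → Set
Twins k u w = ∀ (x : V k) → Adj k u x ⇔ Adj k w x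

-- Flipping a chosen number of the positions where u and w agree, and a chosen
-- number of those where they differ, produces x at any prescribed pair of
-- distances from u and w. Twins must therefore agree on all these distances:
-- if d(u,w) ≤ k, flipping k agreeing positions forces k + d(u,w) = k, so u = w;
-- if d(u,w) ≥ k, flipping k differing positions forces d(u,w) − k = k, so u and
-- w differ everywhere. Conversely d(u,x) + d(u + 𝟏,x) = 2k makes u, u + 𝟏 twins.
module Submission where

open import Defs
open import Data.Nat using (ℕ; _≥_; zero; suc; _+_; _*_; _∸_; _≤_; z≤n; s≤s)
open import Data.Nat.Properties
  using (+-suc; +-comm; module ≤-Reasoning; +-identityʳ; +-cancelˡ-≡; +-cancelʳ-≡; +-cancelʳ-≤; +-monoʳ-≤; ≤-total; m∸n+n≡m)
open import Data.Bool using (Bool; true; false)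
open import Data.Vec using (Vec; []; _∷_)
open import Data.Product using (_×_; _,_; ∃)
open import Data.Sum using (inj₁; inj₂)
open import Relation.Binary.PropositionalEquality
open import Function.Bundles using (_⇔_; mk⇔; Equivalence)
open import Data.Empty using (⊥; ⊥-elim)

hamming-complement : ∀ {n} (u x : Vec Bool n) → hamming u x + hamming (u ⊕ 𝟏) x ≡ n
hamming-complement [] [] = refl
hamming-complement (true ∷ u) (true ∷ x) = trans (+-suc _ _) (cong suc (hamming-complement u x))
hamming-complement (false ∷ u) (false ∷ x) = trans (+-suc _ _) (cong suc (hamming-complement u x))
hamming-complement (true ∷ u) (false ∷ x) = cong suc (hamming-complement u x)
hamming-complement (false ∷ u) (true ∷ x) = cong suc (hamming-complement u x)

hamming≡0⇒≡ : ∀ {n} (u w : Vec Bool n) → hamming u w ≡ 0 → u ≡ w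
hamming≡0⇒≡ [] [] _ = refl
hamming≡0⇒≡ (true ∷ u) (true ∷ w) e = cong (true ∷_) (hamming≡0⇒≡ u w e)
hamming≡0⇒≡ (false ∷ u) (false ∷ w) e = cong (false ∷_) (hamming≡0⇒≡ u w e)

hamming≡n⇒≡⊕𝟏 : ∀ {n} (u w : Vec Bool n) → hamming u w ≡ n → w ≡ u ⊕ 𝟏
hamming≡n⇒≡⊕𝟏 {n} u w e = sym (hamming≡0⇒≡ (u ⊕ 𝟏) w (+-cancelˡ-≡ n _ 0 eq))
  where
  eq : n + hamming (u ⊕ 𝟏) w ≡ n + 0
  eq = trans (cong (_+ hamming (u ⊕ 𝟏) w) (sym e))
             (trans (hamming-complement u w) (sym (+-identityʳ n)))

⊕𝟏≢ : ∀ {n} (u : Vec Bool (suc n)) → u ⊕ 𝟏 ≢ u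
⊕𝟏≢ (true ∷ u) ()
⊕𝟏≢ (false ∷ u) ()

-- hamming (u ⊕ 𝟏) w counts the positions where u and w agree.
∃-at-distances : ∀ {n} (u w : Vec Bool n) (a b : ℕ) →
  a ≤ hamming (u ⊕ 𝟏) w → b ≤ hamming u w →
  ∃ λ x → hamming u x ≡ a + b × hamming w x ≡ a + (hamming u w ∸ b)
∃-at-distances [] [] zero zero _ _ = [] , refl , refl
∃-at-distances (true ∷ u) (true ∷ w) zero b _ b≤ with ∃-at-distances u w zero b z≤n b≤
... | x , p , q = true ∷ x , p , q
∃-at-distances (true ∷ u) (true ∷ w) (suc a) b (s≤s a≤) b≤ with ∃-at-distances u w a b a≤ b≤
... | x , p , q = false ∷ x , cong suc p , cong suc q
∃-at-distances (false ∷ u) (false ∷ w) zero b _ b≤ with ∃-at-distances u w zero b z≤n b≤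
... | x , p , q = false ∷ x , p , q
∃-at-distances (false ∷ u) (false ∷ w) (suc a) b (s≤s a≤) b≤ with ∃-at-distances u w a b a≤ b≤
... | x , p , q = true ∷ x , cong suc p , cong suc q
∃-at-distances (true ∷ u) (false ∷ w) a zero a≤ _ with ∃-at-distances u w a zero a≤ z≤n
... | x , p , q = true ∷ x , p , trans (cong suc q) (sym (+-suc a _))
∃-at-distances (true ∷ u) (false ∷ w) a (suc b) a≤ (s≤s b≤) with ∃-at-distances u w a b a≤ b≤
... | x , p , q = false ∷ x , trans (cong suc p) (sym (+-suc a b)) , q
∃-at-distances (false ∷ u) (true ∷ w) a zero a≤ _ with ∃-at-distances u w a zero a≤ z≤n
... | x , p , q = false ∷ x , p , trans (cong suc q) (sym (+-suc a _))
∃-at-distances (false ∷ u) (true ∷ w) a (suc b) a≤ (s≤s b≤) with ∃-at-distances u w a b a≤ b≤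
... | x , p , q = true ∷ x , trans (cong suc p) (sym (+-suc a b)) , q

2*k≡k+k : ∀ k → 2 * k ≡ k + k
2*k≡k+k k = cong (k +_) (+-identityʳ k)

Twins-⊕𝟏 : ∀ k (u : V k) → Twins k u (u ⊕ 𝟏)
Twins-⊕𝟏 k u x = mk⇔ to from
  where
  sum≡k+k : hamming u x + hamming (u ⊕ 𝟏) x ≡ k + k
  sum≡k+k = trans (hamming-complement u x) (2*k≡k+k k)
  to : hamming u x ≡ k → hamming (u ⊕ 𝟏) x ≡ k
  to e = +-cancelˡ-≡ k _ k (trans (cong (_+ hamming (u ⊕ 𝟏) x) (sym e)) sum≡k+k)
  from : hamming (u ⊕ 𝟏) x ≡ k → hamming u x ≡ k
  from e = +-cancelʳ-≡ k _ k (trans (cong (hamming u x +_) (sym e)) sum≡k+k)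

Twins⇒≡⊕𝟏 : ∀ k (u w : V k) → u ≢ w → Twins k u w → w ≡ u ⊕ 𝟏
Twins⇒≡⊕𝟏 k u w u≢w twins with ≤-total (hamming u w) k
... | inj₁ d≤k = ⊥-elim (u≢w (hamming≡0⇒≡ u w d≡0))
  where
  k≤agree : k ≤ hamming (u ⊕ 𝟏) w
  k≤agree = +-cancelʳ-≤ (hamming u w) k _ (begin
    k + hamming u w                    ≤⟨ +-monoʳ-≤ k d≤k ⟩
    k + k                              ≡⟨ sym (2*k≡k+k k) ⟩
    2 * k                              ≡⟨ sym (hamming-complement u w) ⟩
    hamming u w + hamming (u ⊕ 𝟏) w    ≡⟨ +-comm (hamming u w) _ ⟩
    hamming (u ⊕ 𝟏) w + hamming u w    ∎)
    where open ≤-Reasoning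
  d≡0 : hamming u w ≡ 0
  d≡0 with ∃-at-distances u w k 0 k≤agree z≤n
  ... | x , ux , wx = +-cancelˡ-≡ k _ 0
    (trans (sym wx) (trans (Equivalence.to (twins x) (trans ux (+-identityʳ k)))
                           (sym (+-identityʳ k))))
... | inj₂ k≤d with ∃-at-distances u w 0 k z≤n k≤d
... | x , ux , wx = hamming≡n⇒≡⊕𝟏 u w
  (trans (sym (m∸n+n≡m k≤d)) (trans (cong (_+ k) d∸k≡k) (sym (2*k≡k+k k))))
  where
  d∸k≡k : hamming u w ∸ k ≡ k
  d∸k≡k = trans (sym wx) (Equivalence.to (twins x) ux)

lemma3 : (k : ℕ) → k ≥ 1 →
    (∀ (u w : V k) → u ≢ w → (Twins k u w ⇔ (w ≡ u ⊕ 𝟏)))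
    × (∀ (u : V k) → (u ⊕ 𝟏 ≢ u) × Twins k u (u ⊕ 𝟏))
    × (∀ (u v w : V k) → u ≢ v → v ≢ w → u ≢ w →
    Twins k u v → Twins k v w → Twins k u w → ⊥)
lemma3 k@(suc _) _ = twins⇔≡⊕𝟏 , (λ u → ⊕𝟏≢ u , Twins-⊕𝟏 k u) , no-twin-triple
  where
  twins⇔≡⊕𝟏 : ∀ (u w : V k) → u ≢ w → Twins k u w ⇔ (w ≡ u ⊕ 𝟏)
  twins⇔≡⊕𝟏 u w u≢w = mk⇔ (Twins⇒≡⊕𝟏 k u w u≢w) λ { refl → Twins-⊕𝟏 k u }
  no-twin-triple : ∀ (u v w : V k) → u ≢ v → v ≢ w → u ≢ w →
                   Twins k u v → Twins k v w → Twins k u w → ⊥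
  no-twin-triple u v w u≢v v≢w u≢w uv _ uw =
    v≢w (trans (Twins⇒≡⊕𝟏 k u v u≢v uv) (sym (Twins⇒≡⊕𝟏 k u w u≢w uw)))
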